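{- Let $G=(V,E)$ be an undirected capacitated graph, $\alpha,\beta\ge1$, and let $\mathcal P_1,\ldots,\mathcal P_L$ be partitions of $V$ such that (1) $\mathcal P_1=\{\{v\}:v\in V\}$; (2) for each $i\in[L-1]$, $\{\deg_{\partial\mathcal P_i\cup\partial C}|_C: C\in\mathcal P_{i+1}\}$ mixes simultaneously in $G$ with congestion $\alpha$; (3) for each $i\in[L-1]$ there is a flow in $G$ with congestion $\beta$ in which each $v$ sends $\deg_{\partial\mathcal P_{i+1}}(v)$ and receives at most $\frac12\deg_{\partial\mathcal P_i}(v)$ flow. Let $\mathcal R_{\ge i}=\{C_i\cap\cdots\cap C_L: C_j\in\mathcal P_j,\ C_i\cap\cdots\cap C_L\ne\emptyset\}$. Then for any $i\in[L-1]$ and any $\mathbf x\in\mathbb R^V_{\ge0}$ with $\mathbf x\le\deg_{\partial\mathcal R_{\ge i+1}}$, there exist $\mathbf y\in\mathbb R^V_{\ge0}$ with $\mathbf y\le\deg_{\partial\mathcal P_i}$ and a flow routing the demand $\mathbf x-\mathbf y$ with congestion $(2L-1-2i)\beta$.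
   Context: For $C\subseteq V$, $\partial C$ is the set of edges with exactly one endpoint in $C$. For $F\subseteq E$, $\deg_F(v)$ is the total capacity of edges of $F$ incident to $v$. For a partition $\mathcal P$, $\partial\mathcal P$ is the set of edges with endpoints in different parts. $\mathbf x|_C$ is $\mathbf x$ on $C$, $0$ elsewhere; inequalities entrywise. A flow routes $\mathbf b$ if each $v$ receives net flow $\mathbf b(v)$; congestion is the max ratio of flow to capacity. "Sends $\mathbf x(v)$ and receives at most $\mathbf y(v)$" means $v$ is the source of exactly $\mathbf x(v)$ and sink of at most $\mathbf y(v)$ units. A collection $\{\mathbf d_j\}$ mixes simultaneously with congestion $\alpha$ if for all demands $\mathbf b_j$ with $|\mathbf b_j|\le\mathbf d_j$, $\sum_j\mathbf b_j$ is routable with congestion $\alpha$.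
   Formalization: The capacities, the parameters α and β and the vector x are rational, and the flows, the mixing demands and the vector y are taken in ℚ rather than ℝ. -}

module Defs where

open import Data.Nat using (ℕ; zero; suc)
open import Data.Fin using (Fin; _≟_) renaming (zero to fz; suc to fs)
open import Data.Bool using (Bool; true; false; if_then_else_; _∧_; _∨_; not; _xor_)
open import Data.List using (List; []; _∷_; upTo; map)
open import Data.Rational using (ℚ; 0ℚ; _+_; _-_; _*_; _≤_; _<_; ∣_∣)
open import Data.Product using (Σ; _×_)
open import Relation.Binary.PropositionalEquality using (_≡_)
open import Relation.Nullary.Decidable using (⌊_⌋)

sumF : ∀ {k} → (Fin k → ℚ) → ℚ
sumF {zero} f = 0ℚ
sumF {suc k} f = f fz + sumF (λ i → f (fs i))

_==_ : ∀ {n} → Fin n → Fin n → Bool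
a == b = ⌊ a ≟ b ⌋

-- An undirected capacitated (multi)graph on vertex set Fin n.
-- Edge e joins src e and tgt e (orientation is only a reference direction for flows).
record Graph (n : ℕ) : Set where
  field
    m      : ℕ
    src    : Fin m → Fin n
    tgt    : Fin m → Fin n
    cap    : Fin m → ℚ
    capPos : ∀ e → 0ℚ < cap e
open Graph public

-- A partition of Fin n given by a labelling: u, v lie in the same part iff they
-- have the same label.  Parts are the nonempty label classes.
Partition : ℕ → Set
Partition n = Fin n → Fin n

EdgeSet : ∀ {n} → Graph n → Set
EdgeSet G = Fin (m G) → Bool

incident : ∀ {n} (G : Graph n) → Fin (m G) → Fin n → Bool
incident G e v = (src G e == v) ∨ (tgt G e == v)

deg : ∀ {n} (G : Graph n) → EdgeSet G → Fin n → ℚ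
deg G F v = sumF (λ e → if F e ∧ incident G e v then cap G e else 0ℚ)

∂P : ∀ {n} (G : Graph n) → Partition n → EdgeSet G
∂P G P e = not (P (src G e) == P (tgt G e))

-- ∂C for the part C = {v : P v = c}: edges with exactly one endpoint in C.
∂C : ∀ {n} (G : Graph n) → Partition n → Fin n → EdgeSet G
∂C G P c e = (P (src G e) == c) xor (P (tgt G e) == c)

_∪_ : ∀ {n} {G : Graph n} → EdgeSet G → EdgeSet G → EdgeSet G
(F ∪ F') e = F e ∨ F' e

allL : {A : Set} → (A → Bool) → List A → Bool
allL p [] = true
allL p (x ∷ xs) = p x ∧ allL p xs

-- Indices i, i+1, ..., L.
range : ℕ → ℕ → List ℕ
range i L = map (Data.Nat._+_ i) (upTo (suc (L Data.Nat.∸ i)))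

-- ∂ℛ_{≥i} for the family of partitions P_1..P_L: edge e crosses iff
-- its endpoints differ in some P_j with i ≤ j ≤ L.
∂R≥ : ∀ {n} (G : Graph n) → (ℕ → Partition n) → ℕ → ℕ → EdgeSet G
∂R≥ G P L i e = not (allL (λ j → P j (src G e) == P j (tgt G e)) (range i L))

-- A flow: signed amount on each edge, positive = from src to tgt.
Flow : ∀ {n} → Graph n → Set
Flow G = Fin (m G) → ℚ

netIn : ∀ {n} (G : Graph n) → Flow G → Fin n → ℚ
netIn G f v = sumF (λ e → (if tgt G e == v then f e else 0ℚ)
                        - (if src G e == v then f e else 0ℚ))

Routes : ∀ {n} (G : Graph n) → Flow G → (Fin n → ℚ) → Set
Routes G f b = ∀ v → netIn G f v ≡ b v

CongestionAtMost : ∀ {n} (G : Graph n) → Flow G → ℚ → Set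
CongestionAtMost G f α = ∀ e → ∣ f e ∣ ≤ α * cap G e

Routable : ∀ {n} (G : Graph n) → (Fin n → ℚ) → ℚ → Set
Routable G b α = Σ (Flow G) λ f → Routes G f b × CongestionAtMost G f α

IsDemand : ∀ {n} → (Fin n → ℚ) → Set
IsDemand b = sumF b ≡ 0ℚ

MixesSimultaneously : ∀ {n k} (G : Graph n) → (Fin k → Fin n → ℚ) → ℚ → Set
MixesSimultaneously {n} {k} G d α =
  (b : Fin k → Fin n → ℚ) →
  (∀ c v → ∣ b c v ∣ ≤ d c v) →
  (∀ c → IsDemand (b c)) →
  Routable G (λ v → sumF (λ c → b c v)) α

-- The vector deg_{∂𝒫_i ∪ ∂C}|_C for the part C of 𝒫_{i+1} with label c.
mixVec : ∀ {n} (G : Graph n) → Partition n → Partition n → Fin n → Fin n → ℚ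
mixVec G Pi Pi+1 c v =
  if Pi+1 v == c then deg G (_∪_ {G = G} (∂P G Pi) (∂C G Pi+1 c)) v else 0ℚ

-- The core is a sub-flow lemma: if f routes s − D with s ≥ 0, then for every 0 ≤ z ≤ D
-- there is a flow g with |g| ≤ |f| on every edge that sends z and receives some 0 ≤ y ≤ s.
-- It is proved by cancelling the excess t = D − z greedily.  At a vertex u with t u > 0,
-- either u still has supply s u > 0, which absorbs part of t u, or f carries flow out of u
-- along some edge, and part of t u is pushed along that edge, reducing the flow there.
-- All data stay in (1/Q)ℤ for a common denominator Q, and every step lowers Σ|f| + Σt by at
-- least 1/Q, which bounds the number of steps.
--
-- The claim then follows by downward induction on i.  As ∂ℛ≥(i+1) ⊆ ∂𝒫(i+1) ∪ ∂ℛ≥(i+2),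
-- x splits as x₁ + x₂ with x₁ ≤ deg ∂𝒫(i+1) and x₂ ≤ deg ∂ℛ≥(i+2).  Induction sends x₂
-- back to some y₂ ≤ deg ∂𝒫(i+1) with congestion (2L−3−2i)β, and the sub-flow lemma for
-- twice the flow of hypothesis (3) at level i sends x₁ + y₂ ≤ 2 deg ∂𝒫(i+1) back to some
-- y ≤ 2 · ½ deg ∂𝒫(i) with congestion 2β.  At i = L − 1 the last step alone costs β.

module Submission where

open import Defs
open import Data.Nat using (ℕ; suc; _∸_)
open import Data.Fin using (Fin)
open import Data.Integer using (+_)
open import Data.Rational using (ℚ; 0ℚ; 1ℚ; ½; _/_; _*_; _-_; _≤_)
open import Data.Product using (Σ; _×_)
open import Relation.Binary.PropositionalEquality using (_≡_)

open import Algebra.Bundles using (Ring)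
open import Data.Bool using (Bool; true; false; if_then_else_; _∧_; _∨_; not)
import Data.Bool.Properties as Boolₚ
open import Data.Empty using (⊥-elim)
open import Data.Fin using (_≟_) renaming (zero to fz; suc to fs)
open import Data.Fin.Properties using (any?; suc-injective)
open import Data.Integer as ℤ using (ℤ)
import Data.Integer.Properties as ℤₚ
open import Data.List using ([]; _∷_; map; upTo; applyUpTo)
import Data.List.Properties as Listₚ
open import Data.Nat using (zero; z≤n; s≤s)
import Data.Nat as ℕ
import Data.Nat.Properties as ℕₚ
open import Data.Nat.Tactic.RingSolver using (solve-∀)
open import Data.Product using (_,_)
open import Data.Rational
  using (_+_; -_; _<_; ∣_∣; _⊓_; ↥_; ↧ₙ_; toℚᵘ; mkℚ; positive; nonNegative; *≤*)
open import Data.Rational.Properties hiding (_≟_)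
open import Algebra.Properties.CommutativeMonoid.Sum +-0-commutativeMonoid
  using (sum; ∑-distrib-+; sum-replicate-zero)
open import Algebra.Properties.Semiring.Sum (Ring.semiring +-*-ring)
  using (*-distribˡ-sum)
open import Data.Rational.Solver using (module +-*-Solver)
import Data.Rational.Unnormalised as ℚᵘ
import Data.Rational.Unnormalised.Properties as ℚᵘₚ
open import Data.Sum using (_⊎_; inj₁; inj₂)
open import Function using (_∘_)
open import Relation.Nullary using (yes; no)
open import Relation.Binary.PropositionalEquality
  using (_≢_; refl; sym; trans; cong; cong₂; subst; subst₂; module ≡-Reasoning)

open +-*-Solver using (solve; _:+_; _:-_; :-_; _:*_; con; _:=_)

p≤q⇒0≤q-p : ∀ {p q} → p ≤ q → 0ℚ ≤ q - p
p≤q⇒0≤q-p {p} {q} p≤q = subst (_≤ q - p) (+-inverseʳ p) (+-monoˡ-≤ (- p) p≤q)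

0≤q⇒p-q≤p : ∀ p {q} → 0ℚ ≤ q → p - q ≤ p
0≤q⇒p-q≤p p {q} 0≤q = subst (p - q ≤_) (+-identityʳ p) (+-monoʳ-≤ p (neg-antimono-≤ 0≤q))

+-cancelʳ-≤ : ∀ p q r → p + r ≤ q + r → p ≤ q
+-cancelʳ-≤ p q r p+r≤q+r = subst₂ _≤_ (cancel p) (cancel q) (+-monoˡ-≤ (- r) p+r≤q+r)
  where
  cancel : ∀ x → x + r - r ≡ x
  cancel x = solve 2 (λ x r → x :+ r :- r := x) refl x r

p-q<0⇒p<q : ∀ p q → p - q < 0ℚ → p < q
p-q<0⇒p<q p q p-q<0 = subst₂ _<_ (solve 2 (λ p q → p :- q :+ q := p) refl p q) (+-identityˡ q) (+-monoˡ-< q p-q<0)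

p<q⇒p-q<0 : ∀ {p q} → p < q → p - q < 0ℚ
p<q⇒p-q<0 {p} {q} p<q = subst (p - q <_) (+-inverseʳ q) (+-monoˡ-< (- q) p<q)

0<p*q : ∀ {p q} → 0ℚ < p → 0ℚ < q → 0ℚ < p * q
0<p*q {p} {q} 0<p 0<q = positive⁻¹ (p * q) {{pos*pos⇒pos p {{positive 0<p}} q {{positive 0<q}}}}

0≤p*q : ∀ {p q} → 0ℚ ≤ p → 0ℚ ≤ q → 0ℚ ≤ p * q
0≤p*q {p} {q} 0≤p 0≤q = nonNegative⁻¹ (p * q) {{nonNeg*nonNeg⇒nonNeg p {{nonNegative 0≤p}} q {{nonNegative 0≤q}}}}

0<p⊓q : ∀ {p q} → 0ℚ < p → 0ℚ < q → 0ℚ < p ⊓ q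
0<p⊓q {p} {q} 0<p 0<q with ⊓-sel p q
... | inj₁ p⊓q≡p = subst (0ℚ <_) (sym p⊓q≡p) 0<p
... | inj₂ p⊓q≡q = subst (0ℚ <_) (sym p⊓q≡q) 0<q

p-[p⊓q]≤r : ∀ {p q r} → p ≤ q + r → 0ℚ ≤ r → p - p ⊓ q ≤ r
p-[p⊓q]≤r {p} {q} {r} p≤q+r 0≤r with ⊓-sel p q
... | inj₁ p⊓q≡p = subst (_≤ r) (trans (sym (+-inverseʳ p)) (cong (_-_ p) (sym p⊓q≡p))) 0≤r
... | inj₂ p⊓q≡q = subst (_≤ r) (cong (_-_ p) (sym p⊓q≡q))
                     (subst (p - q ≤_) (solve 2 (λ q r → q :+ r :- q := r) refl q r) (+-monoˡ-≤ (- q) p≤q+r))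

[a+b]-[c+d]≡[a-c]+[b-d] : ∀ a b c d → (a + b) - (c + d) ≡ (a - c) + (b - d)
[a+b]-[c+d]≡[a-c]+[b-d] = solve 4 (λ a b c d → (a :+ b) :- (c :+ d) := (a :- c) :+ (b :- d)) refl

[a-c]-[b-c]≡a-b : ∀ a b c → (a - c) - (b - c) ≡ a - b
[a-c]-[b-c]≡a-b = solve 3 (λ a b c → (a :- c) :- (b :- c) := a :- b) refl

*-distribˡ-minus : ∀ c a b → c * a - c * b ≡ c * (a - b)
*-distribˡ-minus = solve 3 (λ c a b → c :* a :- c :* b := c :* (a :- b)) refl

∣a-δσ∣≡∣a∣-δ : ∀ {σ} → σ ≡ 1ℚ ⊎ σ ≡ - 1ℚ →
  ∀ a δ → 0ℚ ≤ δ → δ ≤ σ * a → ∣ a + - δ * σ ∣ ≡ ∣ a ∣ - δ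
∣a-δσ∣≡∣a∣-δ (inj₁ refl) a δ 0≤δ δ≤1*a = begin
  ∣ a + - δ * 1ℚ ∣  ≡⟨ cong ∣_∣ (cong (_+_ a) (*-identityʳ (- δ))) ⟩
  ∣ a - δ ∣         ≡⟨ 0≤p⇒∣p∣≡p (p≤q⇒0≤q-p δ≤a) ⟩
  a - δ             ≡⟨ cong (_- δ) (sym (0≤p⇒∣p∣≡p (≤-trans 0≤δ δ≤a))) ⟩
  ∣ a ∣ - δ         ∎
  where
  open ≡-Reasoning
  δ≤a = subst (δ ≤_) (*-identityˡ a) δ≤1*a
∣a-δσ∣≡∣a∣-δ (inj₂ refl) a δ 0≤δ δ≤-1*a = begin
  ∣ a + - δ * - 1ℚ ∣
    ≡⟨ cong ∣_∣ (solve 2 (λ a δ → a :+ (:- δ) :* (:- con 1ℚ) := :- ((:- a) :- δ)) refl a δ) ⟩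
  ∣ - (- a - δ) ∣     ≡⟨ ∣-p∣≡∣p∣ (- a - δ) ⟩
  ∣ - a - δ ∣         ≡⟨ 0≤p⇒∣p∣≡p (p≤q⇒0≤q-p δ≤-a) ⟩
  - a - δ             ≡⟨ cong (_- δ) (trans (sym (0≤p⇒∣p∣≡p (≤-trans 0≤δ δ≤-a))) (∣-p∣≡∣p∣ a)) ⟩
  ∣ a ∣ - δ           ∎
  where
  open ≡-Reasoning
  δ≤-a = subst (δ ≤_) (solve 1 (λ a → (:- con 1ℚ) :* a := :- a) refl a) δ≤-1*a

sumF≡sum : ∀ {k} (f : Fin k → ℚ) → sumF f ≡ sum f
sumF≡sum {zero}  f = refl
sumF≡sum {suc k} f = cong (_+_ (f fz)) (sumF≡sum (f ∘ fs))

sumF-cong : ∀ {k} {f g : Fin k → ℚ} → (∀ i → f i ≡ g i) → sumF f ≡ sumF g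
sumF-cong {zero}  f≗g = refl
sumF-cong {suc k} f≗g = cong₂ _+_ (f≗g fz) (sumF-cong (f≗g ∘ fs))

sumF-zero : ∀ k → sumF {k} (λ _ → 0ℚ) ≡ 0ℚ
sumF-zero k = trans (sumF≡sum {k} (λ _ → 0ℚ)) (sum-replicate-zero k)

sumF-distrib-+ : ∀ {k} (f g : Fin k → ℚ) → sumF (λ i → f i + g i) ≡ sumF f + sumF g
sumF-distrib-+ f g = begin
  sumF (λ i → f i + g i) ≡⟨ sumF≡sum (λ i → f i + g i) ⟩
  sum (λ i → f i + g i)  ≡⟨ ∑-distrib-+ f g ⟩
  sum f + sum g          ≡⟨ sym (cong₂ _+_ (sumF≡sum f) (sumF≡sum g)) ⟩
  sumF f + sumF g        ∎
  where open ≡-Reasoning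

sumF-distrib-- : ∀ {k} (f g : Fin k → ℚ) → sumF (λ i → f i - g i) ≡ sumF f - sumF g
sumF-distrib-- {zero}  f g = refl
sumF-distrib-- {suc k} f g = begin
  (f fz - g fz) + sumF (λ i → f (fs i) - g (fs i))
    ≡⟨ cong (_+_ (f fz - g fz)) (sumF-distrib-- (f ∘ fs) (g ∘ fs)) ⟩
  (f fz - g fz) + (sumF (f ∘ fs) - sumF (g ∘ fs))
    ≡⟨ sym ([a+b]-[c+d]≡[a-c]+[b-d] (f fz) (sumF (f ∘ fs)) (g fz) (sumF (g ∘ fs))) ⟩
  (f fz + sumF (f ∘ fs)) - (g fz + sumF (g ∘ fs))
    ∎
  where open ≡-Reasoning

*-distribˡ-sumF : ∀ {k} c (f : Fin k → ℚ) → c * sumF f ≡ sumF (λ i → c * f i)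
*-distribˡ-sumF c f = begin
  c * sumF f             ≡⟨ cong (c *_) (sumF≡sum f) ⟩
  c * sum f              ≡⟨ *-distribˡ-sum c f ⟩
  sum (λ i → c * f i)    ≡⟨ sym (sumF≡sum (λ i → c * f i)) ⟩
  sumF (λ i → c * f i)   ∎
  where open ≡-Reasoning

sumF-mono-≤ : ∀ {k} {f g : Fin k → ℚ} → (∀ i → f i ≤ g i) → sumF f ≤ sumF g
sumF-mono-≤ {zero}  f≤g = ≤-refl
sumF-mono-≤ {suc k} f≤g = +-mono-≤ (f≤g fz) (sumF-mono-≤ (f≤g ∘ fs))

sumF-nonNeg : ∀ {k} {f : Fin k → ℚ} → (∀ i → 0ℚ ≤ f i) → 0ℚ ≤ sumF f
sumF-nonNeg {k} {f} 0≤f = subst (_≤ sumF f) (sumF-zero k) (sumF-mono-≤ 0≤f)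

sumF-single : ∀ {k} (f : Fin k → ℚ) i → (∀ j → i ≢ j → f j ≡ 0ℚ) → sumF f ≡ f i
sumF-single {suc k} f fz     f≡0 = begin
  f fz + sumF (f ∘ fs)       ≡⟨ cong (_+_ (f fz)) (sumF-cong (λ j → f≡0 (fs j) λ ())) ⟩
  f fz + sumF {k} (λ _ → 0ℚ) ≡⟨ cong (_+_ (f fz)) (sumF-zero k) ⟩
  f fz + 0ℚ                  ≡⟨ +-identityʳ (f fz) ⟩
  f fz                       ∎
  where open ≡-Reasoning
sumF-single {suc k} f (fs i) f≡0 = begin
  f fz + sumF (f ∘ fs)       ≡⟨ cong (_+ sumF (f ∘ fs)) (f≡0 fz λ ()) ⟩
  0ℚ + sumF (f ∘ fs)         ≡⟨ +-identityˡ _ ⟩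
  sumF (f ∘ fs)              ≡⟨ sumF-single (f ∘ fs) i (λ j i≢j → f≡0 (fs j) (i≢j ∘ suc-injective)) ⟩
  f (fs i)                   ∎
  where open ≡-Reasoning

sumF-negative : ∀ {k} (f : Fin k → ℚ) → sumF f < 0ℚ → Σ (Fin k) λ i → f i < 0ℚ
sumF-negative {zero}  f 0<0 = ⊥-elim (<-irrefl refl 0<0)
sumF-negative {suc k} f Σf<0 with f fz <? 0ℚ
... | yes f0<0 = fz , f0<0
... | no  f0≮0 with sumF (f ∘ fs) <? 0ℚ
...   | yes rest<0 = let (i , fi<0) = sumF-negative (f ∘ fs) rest<0 in fs i , fi<0
...   | no  rest≮0 = ⊥-elim (<-irrefl refl (<-≤-trans Σf<0 (+-mono-≤ (≮⇒≥ f0≮0) (≮⇒≥ rest≮0))))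

if-nonNeg : ∀ b {x} → 0ℚ ≤ x → 0ℚ ≤ (if b then x else 0ℚ)
if-nonNeg true  0≤x = 0≤x
if-nonNeg false _   = ≤-refl

==-self : ∀ {k} (i : Fin k) {A : Set} {x y : A} → (if i == i then x else y) ≡ x
==-self i with i ≟ i
... | yes _   = refl
... | no i≢i = ⊥-elim (i≢i refl)

==-other : ∀ {k} {i j : Fin k} {A : Set} {x y : A} → i ≢ j → (if i == j then x else y) ≡ y
==-other {i = i} {j} i≢j with i ≟ j
... | yes i≡j = ⊥-elim (i≢j i≡j)
... | no  _   = refl

𝟙[_] : ∀ {k} → Fin k → Fin k → ℚ
𝟙[ i ] j = if i == j then 1ℚ else 0ℚ

0≤c*𝟙 : ∀ {k} {c} (i j : Fin k) → 0ℚ ≤ c → 0ℚ ≤ c * 𝟙[ i ] j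
0≤c*𝟙 {c = c} i j 0≤c with i == j
... | true  = subst (0ℚ ≤_) (sym (*-identityʳ c)) 0≤c
... | false = subst (0ℚ ≤_) (sym (*-zeroʳ c)) ≤-refl

sumF-*𝟙 : ∀ {k} c (i : Fin k) → sumF (λ j → c * 𝟙[ i ] j) ≡ c
sumF-*𝟙 c i = begin
  sumF (λ j → c * 𝟙[ i ] j) ≡⟨ sumF-single _ i (λ j i≢j → trans (cong (c *_) (==-other i≢j)) (*-zeroʳ c)) ⟩
  c * 𝟙[ i ] i              ≡⟨ trans (cong (c *_) (==-self i)) (*-identityʳ c) ⟩
  c                         ∎
  where open ≡-Reasoning

sumF-minus-*𝟙 : ∀ {k} (a : Fin k → ℚ) c i → sumF (λ j → a j - c * 𝟙[ i ] j) ≡ sumF a - c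
sumF-minus-*𝟙 a c i = trans (sumF-distrib-- a (λ j → c * 𝟙[ i ] j)) (cong (_-_ (sumF a)) (sumF-*𝟙 c i))

0≤a-c*𝟙 : ∀ {k} {a : Fin k → ℚ} {c} i → (∀ j → 0ℚ ≤ a j) → c ≤ a i →
  ∀ j → 0ℚ ≤ a j - c * 𝟙[ i ] j
0≤a-c*𝟙 {a = a} {c} i 0≤a c≤ai j with i ≟ j
... | yes refl = p≤q⇒0≤q-p (subst (_≤ a i) (sym (*-identityʳ c)) c≤ai)
... | no  _    = subst (0ℚ ≤_) (sym (solve 2 (λ a c → a :- c :* con 0ℚ := a) refl (a j) c)) (0≤a j)

-- Integers in ℚ and the grid ℤ/Q

-- The form k / 1 is the one in the statement; its laws are transported from ℚᵘ, where they
-- hold by computation.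
ι : ℤ → ℚ
ι k = k / 1

toℚᵘ-ι : ∀ k → toℚᵘ (ι k) ℚᵘ.≃ ℚᵘ.mkℚᵘ k 0
toℚᵘ-ι k = toℚᵘ-fromℚᵘ (ℚᵘ.mkℚᵘ k 0)

ι-homo-+ : ∀ a b → ι (a ℤ.+ b) ≡ ι a + ι b
ι-homo-+ a b = toℚᵘ-injective (begin-equality
  toℚᵘ (ι (a ℤ.+ b))                     ≃⟨ toℚᵘ-ι (a ℤ.+ b) ⟩
  ℚᵘ.mkℚᵘ (a ℤ.+ b) 0                    ≃⟨ ℚᵘ.*≡* (cong (ℤ._* ℤ.+ 1) a+b≡a*1+b*1) ⟩
  ℚᵘ.mkℚᵘ a 0 ℚᵘ.+ ℚᵘ.mkℚᵘ b 0            ≃⟨ ℚᵘₚ.+-cong (toℚᵘ-ι a) (toℚᵘ-ι b) ⟨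
  toℚᵘ (ι a) ℚᵘ.+ toℚᵘ (ι b)             ≃⟨ toℚᵘ-homo-+ (ι a) (ι b) ⟨
  toℚᵘ (ι a + ι b)                       ∎)
  where
  open ℚᵘₚ.≤-Reasoning
  a+b≡a*1+b*1 = cong₂ ℤ._+_ (sym (ℤₚ.*-identityʳ a)) (sym (ℤₚ.*-identityʳ b))

ι-homo-* : ∀ a b → ι (a ℤ.* b) ≡ ι a * ι b
ι-homo-* a b = toℚᵘ-injective (begin-equality
  toℚᵘ (ι (a ℤ.* b))                     ≃⟨ toℚᵘ-ι (a ℤ.* b) ⟩
  ℚᵘ.mkℚᵘ a 0 ℚᵘ.* ℚᵘ.mkℚᵘ b 0            ≃⟨ ℚᵘₚ.*-cong (toℚᵘ-ι a) (toℚᵘ-ι b) ⟨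
  toℚᵘ (ι a) ℚᵘ.* toℚᵘ (ι b)             ≃⟨ toℚᵘ-homo-* (ι a) (ι b) ⟨
  toℚᵘ (ι a * ι b)                       ∎)
  where open ℚᵘₚ.≤-Reasoning

ι-homo‿- : ∀ a → ι (ℤ.- a) ≡ - ι a
ι-homo‿- a = toℚᵘ-injective (begin-equality
  toℚᵘ (ι (ℤ.- a))                       ≃⟨ toℚᵘ-ι (ℤ.- a) ⟩
  ℚᵘ.- ℚᵘ.mkℚᵘ a 0                       ≃⟨ ℚᵘₚ.-‿cong (toℚᵘ-ι a) ⟨
  ℚᵘ.- toℚᵘ (ι a)                        ≃⟨ toℚᵘ-homo‿- (ι a) ⟨
  toℚᵘ (- ι a)                           ∎)
  where open ℚᵘₚ.≤-Reasoning

ι-mono-≤ : ∀ {a b} → a ℤ.≤ b → ι a ≤ ι b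
ι-mono-≤ {a} {b} a≤b = toℚᵘ-cancel-≤ (begin
  toℚᵘ (ι a)   ≃⟨ toℚᵘ-ι a ⟩
  ℚᵘ.mkℚᵘ a 0  ≤⟨ ℚᵘ.*≤* (ℤₚ.*-monoʳ-≤-nonNeg (ℤ.+ 1) a≤b) ⟩
  ℚᵘ.mkℚᵘ b 0  ≃⟨ toℚᵘ-ι b ⟨
  toℚᵘ (ι b)   ∎)
  where open ℚᵘₚ.≤-Reasoning

ι-cancel-< : ∀ {a b} → ι a < ι b → a ℤ.< b
ι-cancel-< {a} {b} ιa<ιb
  with ℚᵘₚ.<-respˡ-≃ (toℚᵘ-ι a) (ℚᵘₚ.<-respʳ-≃ (toℚᵘ-ι b) (toℚᵘ-mono-< ιa<ιb))
... | ℚᵘ.*<* a*1<b*1 = subst₂ ℤ._<_ (ℤₚ.*-identityʳ a) (ℤₚ.*-identityʳ b) a*1<b*1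

[p/d]*d≡p : ∀ p d → (p / suc d) * ι (ℤ.+ suc d) ≡ ι p
[p/d]*d≡p p d = toℚᵘ-injective (begin-equality
  toℚᵘ ((p / suc d) * ι (ℤ.+ suc d))
    ≃⟨ toℚᵘ-homo-* (p / suc d) (ι (ℤ.+ suc d)) ⟩
  toℚᵘ (p / suc d) ℚᵘ.* toℚᵘ (ι (ℤ.+ suc d))
    ≃⟨ ℚᵘₚ.*-cong (toℚᵘ-fromℚᵘ (ℚᵘ.mkℚᵘ p d)) (toℚᵘ-ι (ℤ.+ suc d)) ⟩
  ℚᵘ.mkℚᵘ p d ℚᵘ.* ℚᵘ.mkℚᵘ (ℤ.+ suc d) 0
    ≃⟨ ℚᵘ.*≡* p*d*1≡p*[d*1] ⟩
  ℚᵘ.mkℚᵘ p 0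
    ≃⟨ toℚᵘ-ι p ⟨
  toℚᵘ (ι p)
    ∎)
  where
  open ℚᵘₚ.≤-Reasoning
  p*d*1≡p*[d*1] : p ℤ.* ℤ.+ suc d ℤ.* ℤ.+ 1 ≡ p ℤ.* ℤ.+ (suc d ℕ.* 1)
  p*d*1≡p*[d*1] = trans (ℤₚ.*-identityʳ _) (cong (λ k → p ℤ.* ℤ.+ k) (sym (ℕₚ.*-identityʳ (suc d))))

*-↧≡↥ : ∀ x → x * ι (ℤ.+ ↧ₙ x) ≡ ι (↥ x)
*-↧≡↥ x@(mkℚ p d _) = trans (cong (_* ι (ℤ.+ suc d)) (sym (↥p/↧p≡p x))) ([p/d]*d≡p p d)

0<ι[1+n] : ∀ n → 0ℚ < ι (ℤ.+ suc n)
0<ι[1+n] n = <-≤-trans (positive⁻¹ 1ℚ) (ι-mono-≤ {ℤ.+ 1} {ℤ.+ suc n} (ℤ.+≤+ (s≤s z≤n)))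

i≤+∣i∣ : ∀ i → i ℤ.≤ ℤ.+ ℤ.∣ i ∣
i≤+∣i∣ (ℤ.+ n)    = ℤₚ.≤-refl
i≤+∣i∣ ℤ.-[1+ n ] = ℤ.-≤+

record _∈ℤ/_ (x Q : ℚ) : Set where
  constructor _,_
  field
    numerator : ℤ
    x*Q≡numerator : x * Q ≡ ι numerator

module _ {Q : ℚ} where

  ∈ℤ/-0 : 0ℚ ∈ℤ/ Q
  ∈ℤ/-0 = ℤ.+ 0 , *-zeroˡ Q

  ∈ℤ/-+ : ∀ {x y} → x ∈ℤ/ Q → y ∈ℤ/ Q → (x + y) ∈ℤ/ Q
  ∈ℤ/-+ {x} {y} (a , xQ≡a) (b , yQ≡b) =
    a ℤ.+ b , trans (*-distribʳ-+ Q x y) (trans (cong₂ _+_ xQ≡a yQ≡b) (sym (ι-homo-+ a b)))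

  ∈ℤ/-neg : ∀ {x} → x ∈ℤ/ Q → (- x) ∈ℤ/ Q
  ∈ℤ/-neg {x} (a , xQ≡a) =
    ℤ.- a , trans (sym (neg-distribˡ-* x Q)) (trans (cong -_ xQ≡a) (sym (ι-homo‿- a)))

  ∈ℤ/-- : ∀ {x y} → x ∈ℤ/ Q → y ∈ℤ/ Q → (x - y) ∈ℤ/ Q
  ∈ℤ/-- x∈ y∈ = ∈ℤ/-+ x∈ (∈ℤ/-neg y∈)

  ∈ℤ/-∣∣ : ∀ {x} → x ∈ℤ/ Q → ∣ x ∣ ∈ℤ/ Q
  ∈ℤ/-∣∣ {x} x∈ with ∣p∣≡p∨∣p∣≡-p x
  ... | inj₁ ∣x∣≡x  = subst (_∈ℤ/ Q) (sym ∣x∣≡x) x∈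
  ... | inj₂ ∣x∣≡-x = subst (_∈ℤ/ Q) (sym ∣x∣≡-x) (∈ℤ/-neg x∈)

  ∈ℤ/-⊓ : ∀ {x y} → x ∈ℤ/ Q → y ∈ℤ/ Q → (x ⊓ y) ∈ℤ/ Q
  ∈ℤ/-⊓ {x} {y} x∈ y∈ with ⊓-sel x y
  ... | inj₁ x⊓y≡x = subst (_∈ℤ/ Q) (sym x⊓y≡x) x∈
  ... | inj₂ x⊓y≡y = subst (_∈ℤ/ Q) (sym x⊓y≡y) y∈

  ∈ℤ/-sumF : ∀ {k} {f : Fin k → ℚ} → (∀ i → f i ∈ℤ/ Q) → sumF f ∈ℤ/ Q
  ∈ℤ/-sumF {zero}  f∈ = ∈ℤ/-0
  ∈ℤ/-sumF {suc k} f∈ = ∈ℤ/-+ (f∈ fz) (∈ℤ/-sumF (f∈ ∘ fs))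

  ∈ℤ/-*𝟙 : ∀ {k} {c} (i j : Fin k) → c ∈ℤ/ Q → (c * 𝟙[ i ] j) ∈ℤ/ Q
  ∈ℤ/-*𝟙 {c = c} i j c∈ with i == j
  ... | true  = subst (_∈ℤ/ Q) (sym (*-identityʳ c)) c∈
  ... | false = subst (_∈ℤ/ Q) (sym (*-zeroʳ c)) ∈ℤ/-0

  ∈ℤ/-*±1 : ∀ {x σ} → σ ≡ 1ℚ ⊎ σ ≡ - 1ℚ → x ∈ℤ/ Q → (x * σ) ∈ℤ/ Q
  ∈ℤ/-*±1 {x} (inj₁ refl) x∈ = subst (_∈ℤ/ Q) (sym (*-identityʳ x)) x∈
  ∈ℤ/-*±1 {x} (inj₂ refl) x∈ = subst (_∈ℤ/ Q) (solve 1 (λ x → :- x := x :* (:- con 1ℚ)) refl x) (∈ℤ/-neg x∈)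

  ∈ℤ/-scaleʳ : ∀ {x} → x ∈ℤ/ Q → ∀ j → x ∈ℤ/ (Q * ι j)
  ∈ℤ/-scaleʳ {x} (a , xQ≡a) j = a ℤ.* j , (begin
    x * (Q * ι j)  ≡⟨ sym (*-assoc x Q (ι j)) ⟩
    x * Q * ι j    ≡⟨ cong (_* ι j) xQ≡a ⟩
    ι a * ι j      ≡⟨ sym (ι-homo-* a j) ⟩
    ι (a ℤ.* j)    ∎)
    where open ≡-Reasoning

  ∈ℤ/-scaleˡ : ∀ {x} → x ∈ℤ/ Q → ∀ j → x ∈ℤ/ (ι j * Q)
  ∈ℤ/-scaleˡ x∈ j = subst (_ ∈ℤ/_) (*-comm Q (ι j)) (∈ℤ/-scaleʳ x∈ j)

  ∈ℤ/-discrete : 0ℚ < Q → ∀ {x} → x ∈ℤ/ Q → 0ℚ < x → 1ℚ ≤ x * Q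
  ∈ℤ/-discrete 0<Q {x} (k , xQ≡k) 0<x =
    subst (1ℚ ≤_) (sym xQ≡k) (ι-mono-≤ {ℤ.+ 1} {k} (0<k⇒1≤k (ι-cancel-< {ℤ.+ 0} {k} 0<ιk)))
    where
    0<ιk : 0ℚ < ι k
    0<ιk = subst (0ℚ <_) xQ≡k (0<p*q 0<x 0<Q)
    0<k⇒1≤k : ∀ {k} → ℤ.+ 0 ℤ.< k → ℤ.+ 1 ℤ.≤ k
    0<k⇒1≤k (ℤ.+<+ 0<n) = ℤ.+≤+ 0<n

commonDenominator : ∀ {k} (h : Fin k → ℚ) → Σ ℤ λ j → 0ℚ < ι j × (∀ i → h i ∈ℤ/ ι j)
commonDenominator {zero}  h = ℤ.+ 1 , positive⁻¹ 1ℚ , λ ()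
commonDenominator {suc k} h with commonDenominator (h ∘ fs)
... | j , 0<ιj , rest∈ = d ℤ.* j , subst (0ℚ <_) (sym (ι-homo-* d j)) (0<p*q 0<ιd 0<ιj) , h∈
  where
  d = ℤ.+ ↧ₙ h fz
  0<ιd : 0ℚ < ι d
  0<ιd = 0<ι[1+n] (ℕ.pred (↧ₙ h fz))
  h∈ : ∀ i → h i ∈ℤ/ ι (d ℤ.* j)
  h∈ fz     = subst (h fz ∈ℤ/_) (sym (ι-homo-* d j)) (∈ℤ/-scaleʳ (↥ h fz , *-↧≡↥ (h fz)) j)
  h∈ (fs i) = subst (h (fs i) ∈ℤ/_) (sym (ι-homo-* d j)) (∈ℤ/-scaleˡ (rest∈ i) d)

module _ {n} (G : Graph n) where

  netInVia : Flow G → Fin (m G) → Fin n → ℚ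
  netInVia f e v = (if tgt G e == v then f e else 0ℚ) - (if src G e == v then f e else 0ℚ)

  private
    if-+ : ∀ b x y → (if b then x + y else 0ℚ) ≡ (if b then x else 0ℚ) + (if b then y else 0ℚ)
    if-+ true  x y = refl
    if-+ false x y = refl

    if-* : ∀ b c x → (if b then c * x else 0ℚ) ≡ c * (if b then x else 0ℚ)
    if-* true  c x = refl
    if-* false c x = sym (*-zeroʳ c)

  netIn-+ : ∀ f g v → netIn G (λ e → f e + g e) v ≡ netIn G f v + netIn G g v
  netIn-+ f g v = trans (sumF-cong via-+) (sumF-distrib-+ (λ e → netInVia f e v) (λ e → netInVia g e v))
    where
    via-+ : ∀ e → netInVia (λ e → f e + g e) e v ≡ netInVia f e v + netInVia g e v
    via-+ e = trans (cong₂ _-_ (if-+ T (f e) (g e)) (if-+ S (f e) (g e)))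
      ([a+b]-[c+d]≡[a-c]+[b-d] (if T then f e else 0ℚ) (if T then g e else 0ℚ)
                               (if S then f e else 0ℚ) (if S then g e else 0ℚ))
      where T = tgt G e == v; S = src G e == v

  netIn-* : ∀ c f v → netIn G (λ e → c * f e) v ≡ c * netIn G f v
  netIn-* c f v = trans (sumF-cong via-*) (sym (*-distribˡ-sumF c (λ e → netInVia f e v)))
    where
    via-* : ∀ e → netInVia (λ e → c * f e) e v ≡ c * netInVia f e v
    via-* e = trans (cong₂ _-_ (if-* T c (f e)) (if-* S c (f e)))
      (*-distribˡ-minus c (if T then f e else 0ℚ) (if S then f e else 0ℚ))
      where T = tgt G e == v; S = src G e == v

  netIn-𝟙 : ∀ e v → netIn G 𝟙[ e ] v ≡ 𝟙[ tgt G e ] v - 𝟙[ src G e ] v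
  netIn-𝟙 e v = trans (sumF-single (λ e′ → netInVia 𝟙[ e ] e′ v) e off-e)
                      (cong₂ _-_ (at-e (tgt G e)) (at-e (src G e)))
    where
    at-e : ∀ w → (if w == v then 𝟙[ e ] e else 0ℚ) ≡ 𝟙[ w ] v
    at-e w = cong (λ x → if w == v then x else 0ℚ) (==-self e)
    if-0 : ∀ b → (if b then 0ℚ else 0ℚ) ≡ 0ℚ
    if-0 true  = refl
    if-0 false = refl
    off-e : ∀ e′ → e ≢ e′ → netInVia 𝟙[ e ] e′ v ≡ 0ℚ
    off-e e′ e≢e′ rewrite ==-other {x = 1ℚ} {0ℚ} e≢e′ =
      cong₂ _-_ (if-0 (tgt G e′ == v)) (if-0 (src G e′ == v))

Routable-+ : ∀ {n} (G : Graph n) {a b : Fin n → ℚ} {c c′} →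
  Routable G a c → Routable G b c′ → Routable G (λ v → a v + b v) (c + c′)
Routable-+ G {c = c} {c′} (f , f-routes , f-cong) (g , g-routes , g-cong) =
  (λ e → f e + g e) ,
  (λ v → trans (netIn-+ G f g v) (cong₂ _+_ (f-routes v) (g-routes v))) ,
  (λ e → ≤-trans (∣p+q∣≤∣p∣+∣q∣ (f e) (g e))
           (subst (_ ≤_) (sym (*-distribʳ-+ (cap G e) c c′)) (+-mono-≤ (f-cong e) (g-cong e))))

Routable-cong : ∀ {n} (G : Graph n) {a b : Fin n → ℚ} {c c′} →
  (∀ v → a v ≡ b v) → c ≡ c′ → Routable G a c → Routable G b c′
Routable-cong G a≗b refl (f , f-routes , f-cong) = f , (λ v → trans (f-routes v) (a≗b v)) , f-cong

-- Dominated sub-flows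

record SubFlow {n} (G : Graph n) (f : Flow G) (s z : Fin n → ℚ) : Set where
  field
    flow       : Flow G
    received   : Fin n → ℚ
    received≥0 : ∀ v → 0ℚ ≤ received v
    received≤s : ∀ v → received v ≤ s v
    routes     : Routes G flow (λ v → received v - z v)
    dominated  : ∀ e → ∣ flow e ∣ ≤ ∣ f e ∣

SubFlow-weaken : ∀ {n} {G : Graph n} {f f′ : Flow G} {s s′ z z′ : Fin n → ℚ} →
  (∀ e → ∣ f′ e ∣ ≤ ∣ f e ∣) → (∀ v → s′ v ≤ s v) → (∀ v → z′ v ≡ z v) →
  SubFlow G f′ s′ z′ → SubFlow G f s z
SubFlow-weaken f′≤f s′≤s z′≡z sub = record
  { flow       = flow
  ; received   = received
  ; received≥0 = received≥0
  ; received≤s = λ v → ≤-trans (received≤s v) (s′≤s v)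
  ; routes     = λ v → trans (routes v) (cong (_-_ (received v)) (z′≡z v))
  ; dominated  = λ e → ≤-trans (dominated e) (f′≤f e)
  }
  where open SubFlow sub

record Outgoing {n} (G : Graph n) (f : Flow G) (u : Fin n) (e : Fin (m G)) : Set where
  field
    head      : Fin n
    σ         : ℚ
    σ≡±1      : σ ≡ 1ℚ ⊎ σ ≡ - 1ℚ
    u≢head    : u ≢ head
    0<σf      : 0ℚ < σ * f e
    direction : ∀ x → σ * netIn G 𝟙[ e ] x ≡ 𝟙[ head ] x - 𝟙[ u ] x

outgoing : ∀ {n} (G : Graph n) (f : Flow G) u e → netInVia G f e u < 0ℚ → Outgoing G f u e
outgoing G f u e via<0 with tgt G e ≟ u | src G e ≟ u
... | yes _ | yes _ = ⊥-elim (<-irrefl refl (p-q<0⇒p<q (f e) (f e) via<0))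
... | no  _ | no  _ = ⊥-elim (<-irrefl refl via<0)
... | yes refl | no src≢u = record
  { head = src G e ; σ = - 1ℚ ; σ≡±1 = inj₂ refl ; u≢head = src≢u ∘ sym
  ; 0<σf = subst (0ℚ <_) (solve 1 (λ a → :- a := (:- con 1ℚ) :* a) refl (f e))
                 (neg-antimono-< (subst (_< 0ℚ) (+-identityʳ (f e)) via<0))
  ; direction = λ x → trans (cong (- 1ℚ *_) (netIn-𝟙 G e x))
                  (solve 2 (λ a b → (:- con 1ℚ) :* (a :- b) := b :- a) refl (𝟙[ tgt G e ] x) (𝟙[ src G e ] x))
  }
... | no tgt≢u | yes refl = record
  { head = tgt G e ; σ = 1ℚ ; σ≡±1 = inj₁ refl ; u≢head = tgt≢u ∘ sym
  ; 0<σf = subst (0ℚ <_) (sym (*-identityˡ (f e))) (p-q<0⇒p<q 0ℚ (f e) via<0)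
  ; direction = λ x → trans (*-identityˡ _) (netIn-𝟙 G e x)
  }

module Cancellation {n} (G : Graph n) (Q : ℚ) (0<Q : 0ℚ < Q) where

  record Invariant (f : Flow G) (s D t : Fin n → ℚ) : Set where
    field
      s≥0    : ∀ v → 0ℚ ≤ s v
      t≥0    : ∀ v → 0ℚ ≤ t v
      t≤D    : ∀ v → t v ≤ D v
      routes : Routes G f (λ v → s v - D v)
      f∈ℤ/Q  : ∀ e → f e ∈ℤ/ Q
      s∈ℤ/Q  : ∀ v → s v ∈ℤ/ Q
      t∈ℤ/Q  : ∀ v → t v ∈ℤ/ Q

  potential : Flow G → (Fin n → ℚ) → ℚ
  potential f t = sumF (λ e → ∣ f e ∣) + sumF t

  potential-nonNeg : ∀ f {t} → (∀ v → 0ℚ ≤ t v) → 0ℚ ≤ potential f t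
  potential-nonNeg f t≥0 = +-mono-≤ (sumF-nonNeg (λ e → 0≤∣p∣ (f e))) (sumF-nonNeg t≥0)

  potential-∈ℤ/Q : ∀ {f s D t} → Invariant f s D t → potential f t ∈ℤ/ Q
  potential-∈ℤ/Q inv = ∈ℤ/-+ (∈ℤ/-sumF (λ e → ∈ℤ/-∣∣ (f∈ℤ/Q e))) (∈ℤ/-sumF t∈ℤ/Q)
    where open Invariant inv

  record Step (f : Flow G) (s D t : Fin n → ℚ) : Set where
    field
      f′             : Flow G
      s′ D′ t′       : Fin n → ℚ
      δ              : ℚ
      invariant′     : Invariant f′ s′ D′ t′
      1≤δQ           : 1ℚ ≤ δ * Q
      potential-drop : potential f′ t′ + δ ≡ potential f t
      f′≤f           : ∀ e → ∣ f′ e ∣ ≤ ∣ f e ∣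
      s′≤s           : ∀ v → s′ v ≤ s v
      D′-t′≡D-t      : ∀ v → D′ v - t′ v ≡ D v - t v

  absorb : ∀ {f s D t} → Invariant f s D t → ∀ u → 0ℚ < t u → 0ℚ < s u → Step f s D t
  absorb {f} {s} {D} {t} inv u 0<tu 0<su = record
    { f′ = f ; s′ = lower s ; D′ = lower D ; t′ = lower t ; δ = δ
    ; invariant′ = record
      { s≥0    = 0≤a-c*𝟙 u s≥0 (p⊓q≤q (t u) (s u))
      ; t≥0    = 0≤a-c*𝟙 u t≥0 (p⊓q≤p (t u) (s u))
      ; t≤D    = λ v → +-monoˡ-≤ _ (t≤D v)
      ; routes = λ v → trans (routes v) (sym ([a-c]-[b-c]≡a-b (s v) (D v) (δ * 𝟙[ u ] v)))
      ; f∈ℤ/Q  = f∈ℤ/Q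
      ; s∈ℤ/Q  = λ v → ∈ℤ/-- (s∈ℤ/Q v) (∈ℤ/-*𝟙 u v δ∈ℤ/Q)
      ; t∈ℤ/Q  = λ v → ∈ℤ/-- (t∈ℤ/Q v) (∈ℤ/-*𝟙 u v δ∈ℤ/Q)
      }
    ; 1≤δQ = ∈ℤ/-discrete 0<Q δ∈ℤ/Q (0<p⊓q 0<tu 0<su)
    ; potential-drop = begin
        Σ∣f∣ + sumF (lower t) + δ  ≡⟨ cong (λ T → Σ∣f∣ + T + δ) (sumF-minus-*𝟙 t δ u) ⟩
        Σ∣f∣ + (sumF t - δ) + δ    ≡⟨ solve 3 (λ a b d → a :+ (b :- d) :+ d := a :+ b) refl Σ∣f∣ (sumF t) δ ⟩
        Σ∣f∣ + sumF t              ∎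
    ; f′≤f = λ _ → ≤-refl
    ; s′≤s = λ v → 0≤q⇒p-q≤p (s v) (0≤c*𝟙 u v (<⇒≤ (0<p⊓q 0<tu 0<su)))
    ; D′-t′≡D-t = λ v → [a-c]-[b-c]≡a-b (D v) (t v) (δ * 𝟙[ u ] v)
    }
    where
    open Invariant inv
    open ≡-Reasoning
    Σ∣f∣ = sumF (λ e → ∣ f e ∣)
    δ = t u ⊓ s u
    δ∈ℤ/Q = ∈ℤ/-⊓ (t∈ℤ/Q u) (s∈ℤ/Q u)
    lower : (Fin n → ℚ) → Fin n → ℚ
    lower a v = a v - δ * 𝟙[ u ] v

  push : ∀ {f s D t} → Invariant f s D t → ∀ u → 0ℚ < t u → ∀ e → Outgoing G f u e → Step f s D t
  push {f} {s} {D} {t} inv u 0<tu e out = record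
    { f′ = f′ ; s′ = s ; D′ = shift D ; t′ = shift t ; δ = δ
    ; invariant′ = record
      { s≥0    = s≥0
      ; t≥0    = λ v → +-mono-≤ (0≤a-c*𝟙 u t≥0 (p⊓q≤p (t u) (σ * f e)) v) (0≤c*𝟙 head v 0≤δ)
      ; t≤D    = λ v → +-monoˡ-≤ _ (+-monoˡ-≤ _ (t≤D v))
      ; routes = routes′
      ; f∈ℤ/Q  = λ e′ → ∈ℤ/-+ (f∈ℤ/Q e′) (∈ℤ/-*𝟙 e e′ (∈ℤ/-*±1 σ≡±1 (∈ℤ/-neg δ∈ℤ/Q)))
      ; s∈ℤ/Q  = s∈ℤ/Q
      ; t∈ℤ/Q  = λ v → ∈ℤ/-+ (∈ℤ/-- (t∈ℤ/Q v) (∈ℤ/-*𝟙 u v δ∈ℤ/Q)) (∈ℤ/-*𝟙 head v δ∈ℤ/Q)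
      }
    ; 1≤δQ = ∈ℤ/-discrete 0<Q δ∈ℤ/Q 0<δ
    ; potential-drop = begin
        sumF (λ e′ → ∣ f′ e′ ∣) + sumF (shift t) + δ
          ≡⟨ cong₂ (λ F T → F + T + δ) sumF-∣f′∣ sumF-shift ⟩
        (sumF (λ e′ → ∣ f e′ ∣) - δ) + sumF t + δ
          ≡⟨ solve 3 (λ a b d → (a :- d) :+ b :+ d := a :+ b) refl
               (sumF (λ e′ → ∣ f e′ ∣)) (sumF t) δ ⟩
        sumF (λ e′ → ∣ f e′ ∣) + sumF t
          ∎
    ; f′≤f = λ e′ → subst (_≤ ∣ f e′ ∣) (sym (∣f′∣≡∣f∣-δ𝟙 e′))
                          (0≤q⇒p-q≤p ∣ f e′ ∣ (0≤c*𝟙 e e′ 0≤δ))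
    ; s′≤s = λ _ → ≤-refl
    ; D′-t′≡D-t = λ v → solve 4 (λ D t c d → (D :- c :+ d) :- (t :- c :+ d) := D :- t) refl
                          (D v) (t v) (δ * 𝟙[ u ] v) (δ * 𝟙[ head ] v)
    }
    where
    open Invariant inv
    open Outgoing out
    open ≡-Reasoning
    δ = t u ⊓ (σ * f e)
    0<δ = 0<p⊓q 0<tu 0<σf
    0≤δ = <⇒≤ 0<δ
    δ∈ℤ/Q = ∈ℤ/-⊓ (t∈ℤ/Q u) (subst (_∈ℤ/ Q) (*-comm (f e) σ) (∈ℤ/-*±1 σ≡±1 (f∈ℤ/Q e)))

    f′ : Flow G
    f′ e′ = f e′ + (- δ * σ) * 𝟙[ e ] e′

    shift : (Fin n → ℚ) → Fin n → ℚ
    shift a v = a v - δ * 𝟙[ u ] v + δ * 𝟙[ head ] v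

    ∣f′∣≡∣f∣-δ𝟙 : ∀ e′ → ∣ f′ e′ ∣ ≡ ∣ f e′ ∣ - δ * 𝟙[ e ] e′
    ∣f′∣≡∣f∣-δ𝟙 e′ with e ≟ e′
    ... | yes refl = begin
      ∣ f e + (- δ * σ) * 1ℚ ∣  ≡⟨ cong (λ x → ∣ f e + x ∣) (*-identityʳ (- δ * σ)) ⟩
      ∣ f e + - δ * σ ∣         ≡⟨ ∣a-δσ∣≡∣a∣-δ σ≡±1 (f e) δ 0≤δ (p⊓q≤q (t u) (σ * f e)) ⟩
      ∣ f e ∣ - δ               ≡⟨ cong (_-_ ∣ f e ∣) (sym (*-identityʳ δ)) ⟩
      ∣ f e ∣ - δ * 1ℚ          ∎
    ... | no _ = begin
      ∣ f e′ + (- δ * σ) * 0ℚ ∣ ≡⟨ cong (λ x → ∣ f e′ + x ∣) (*-zeroʳ (- δ * σ)) ⟩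
      ∣ f e′ + 0ℚ ∣             ≡⟨ cong ∣_∣ (+-identityʳ (f e′)) ⟩
      ∣ f e′ ∣                  ≡⟨ solve 2 (λ a d → a := a :- d :* con 0ℚ) refl ∣ f e′ ∣ δ ⟩
      ∣ f e′ ∣ - δ * 0ℚ         ∎

    sumF-∣f′∣ : sumF (λ e′ → ∣ f′ e′ ∣) ≡ sumF (λ e′ → ∣ f e′ ∣) - δ
    sumF-∣f′∣ = trans (sumF-cong ∣f′∣≡∣f∣-δ𝟙) (sumF-minus-*𝟙 (λ e′ → ∣ f e′ ∣) δ e)

    sumF-shift : sumF (shift t) ≡ sumF t
    sumF-shift = begin
      sumF (shift t)
        ≡⟨ sumF-distrib-+ (λ v → t v - δ * 𝟙[ u ] v) (λ v → δ * 𝟙[ head ] v) ⟩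
      sumF (λ v → t v - δ * 𝟙[ u ] v) + sumF (λ v → δ * 𝟙[ head ] v)
        ≡⟨ cong₂ _+_ (sumF-minus-*𝟙 t δ u) (sumF-*𝟙 δ head) ⟩
      sumF t - δ + δ
        ≡⟨ solve 2 (λ a d → a :- d :+ d := a) refl (sumF t) δ ⟩
      sumF t
        ∎

    routes′ : Routes G f′ (λ v → s v - shift D v)
    routes′ v = begin
      netIn G f′ v
        ≡⟨ netIn-+ G f (λ e′ → (- δ * σ) * 𝟙[ e ] e′) v ⟩
      netIn G f v + netIn G (λ e′ → (- δ * σ) * 𝟙[ e ] e′) v
        ≡⟨ cong₂ _+_ (routes v) (netIn-* G (- δ * σ) 𝟙[ e ] v) ⟩
      (s v - D v) + (- δ * σ) * netIn G 𝟙[ e ] v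
        ≡⟨ cong (_+_ (s v - D v)) (trans (*-assoc (- δ) σ _) (cong (- δ *_) (direction v))) ⟩
      (s v - D v) + - δ * (𝟙[ head ] v - 𝟙[ u ] v)
        ≡⟨ solve 5 (λ s D d a b → (s :- D) :+ (:- d) :* (b :- a) := s :- (D :- d :* a :+ d :* b)) refl
             (s v) (D v) δ (𝟙[ u ] v) (𝟙[ head ] v) ⟩
      s v - shift D v
        ∎

  step : ∀ {f s D t} → Invariant f s D t → ∀ u → 0ℚ < t u → Step f s D t
  step {f} {s} {D} {t} inv u 0<tu with 0ℚ <? s u
  ... | yes 0<su = absorb inv u 0<tu 0<su
  ... | no  0≮su =
    let (e , via<0) = sumF-negative (λ e → netInVia G f e u) netIn<0
    in  push inv u 0<tu e (outgoing G f u e via<0)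
    where
    open Invariant inv
    netIn<0 : netIn G f u < 0ℚ
    netIn<0 = subst (_< 0ℚ) (sym (routes u))
                (p<q⇒p-q<0 (≤-<-trans (≮⇒≥ 0≮su) (<-≤-trans 0<tu (t≤D u))))

  reduce : ∀ N {f s D t} → Invariant f s D t → potential f t * Q ≤ ι (ℤ.+ N) →
           SubFlow G f s (λ v → D v - t v)
  descend : ∀ N {f s D t} → Step f s D t → potential f t * Q ≤ ι (ℤ.+ N) →
            SubFlow G f s (λ v → D v - t v)

  reduce N {f} {s} {D} {t} inv fuel with any? (λ u → 0ℚ <? t u)
  ... | yes (u , 0<tu) = descend N (step inv u 0<tu) fuel
  ... | no  ∄u = record
    { flow = f ; received = s ; received≥0 = s≥0 ; received≤s = λ _ → ≤-refl
    ; routes = λ v → trans (routes v) (cong (_-_ (s v)) (D≡D-t v))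
    ; dominated = λ _ → ≤-refl
    }
    where
    open Invariant inv
    D≡D-t : ∀ v → D v ≡ D v - t v
    D≡D-t v = trans (sym (+-identityʳ (D v)))
                    (cong (_-_ (D v)) (sym (≤-antisym (≮⇒≥ (λ 0<tv → ∄u (v , 0<tv))) (t≥0 v))))

  descend N {f} {s} {D} {t} st fuel = go N fuel′
    where
    open Step st
    p′ = potential f′ t′
    fuel′ : p′ * Q + 1ℚ ≤ ι (ℤ.+ N)
    fuel′ = begin
      p′ * Q + 1ℚ          ≤⟨ +-monoʳ-≤ (p′ * Q) 1≤δQ ⟩
      p′ * Q + δ * Q       ≡⟨ sym (*-distribʳ-+ Q p′ δ) ⟩
      (p′ + δ) * Q         ≡⟨ cong (_* Q) potential-drop ⟩
      potential f t * Q    ≤⟨ fuel ⟩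
      ι (ℤ.+ N)            ∎
      where open ≤-Reasoning
    go : ∀ M → p′ * Q + 1ℚ ≤ ι (ℤ.+ M) → SubFlow G f s (λ v → D v - t v)
    go zero    fuel″ = ⊥-elim (<-irrefl refl (<-≤-trans 0<p′Q+1 fuel″))
      where
      0<p′Q+1 : 0ℚ < p′ * Q + 1ℚ
      0<p′Q+1 = +-mono-≤-< (0≤p*q (potential-nonNeg f′ (Invariant.t≥0 invariant′)) (<⇒≤ 0<Q))
                           (positive⁻¹ 1ℚ)
    go (suc M) fuel″ = SubFlow-weaken f′≤f s′≤s D′-t′≡D-t (reduce M invariant′
      (+-cancelʳ-≤ (p′ * Q) (ι (ℤ.+ M)) 1ℚ (subst (p′ * Q + 1ℚ ≤_) ι[1+M]≡ι[M]+1 fuel″)))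
      where
      ι[1+M]≡ι[M]+1 : ι (ℤ.+ suc M) ≡ ι (ℤ.+ M) + 1ℚ
      ι[1+M]≡ι[M]+1 = trans (ι-homo-+ (ℤ.+ 1) (ℤ.+ M)) (+-comm 1ℚ (ι (ℤ.+ M)))

subflow : ∀ {n} (G : Graph n) (f : Flow G) (s D z : Fin n → ℚ) →
  (∀ v → 0ℚ ≤ s v) → Routes G f (λ v → s v - D v) →
  (∀ v → 0ℚ ≤ z v) → (∀ v → z v ≤ D v) → SubFlow G f s z
subflow G f s D z s≥0 f-routes z≥0 z≤D
  with commonDenominator f | commonDenominator s | commonDenominator (λ v → D v - z v)
... | j₁ , 0<j₁ , f∈ | j₂ , 0<j₂ , s∈ | j₃ , 0<j₃ , t∈ =
  SubFlow-weaken (λ _ → ≤-refl) (λ _ → ≤-refl) D-[D-z]≡z (reduce ℤ.∣ k ∣ inv fuel)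
  where
  Q = ι j₁ * ι j₂ * ι j₃
  open Cancellation G Q (0<p*q (0<p*q 0<j₁ 0<j₂) 0<j₃)
  inv : Invariant f s D (λ v → D v - z v)
  inv = record
    { s≥0    = s≥0
    ; t≥0    = λ v → p≤q⇒0≤q-p (z≤D v)
    ; t≤D    = λ v → 0≤q⇒p-q≤p (D v) (z≥0 v)
    ; routes = f-routes
    ; f∈ℤ/Q  = λ e → ∈ℤ/-scaleʳ (∈ℤ/-scaleʳ (f∈ e) j₂) j₃
    ; s∈ℤ/Q  = λ v → ∈ℤ/-scaleʳ (∈ℤ/-scaleˡ (s∈ v) j₁) j₃
    ; t∈ℤ/Q  = λ v → subst (_ ∈ℤ/_) (cong (_* ι j₃) (ι-homo-* j₁ j₂))
                           (∈ℤ/-scaleˡ (t∈ v) (j₁ ℤ.* j₂))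
    }
  open _∈ℤ/_ (potential-∈ℤ/Q inv) renaming (numerator to k; x*Q≡numerator to pQ≡k)
  fuel : potential f (λ v → D v - z v) * Q ≤ ι (ℤ.+ ℤ.∣ k ∣)
  fuel = subst (_≤ ι (ℤ.+ ℤ.∣ k ∣)) (sym pQ≡k) (ι-mono-≤ {k} {ℤ.+ ℤ.∣ k ∣} (i≤+∣i∣ k))
  D-[D-z]≡z : ∀ v → D v - (D v - z v) ≡ z v
  D-[D-z]≡z v = solve 2 (λ d z → d :- (d :- z) := z) refl (D v) (z v)

-- Degrees and the boundary of ℛ≥

deg-cong : ∀ {n} (G : Graph n) {F F′ : EdgeSet G} → (∀ e → F e ≡ F′ e) →
  ∀ v → deg G F v ≡ deg G F′ v
deg-cong G F≗F′ v = sumF-cong (λ e → cong (λ b → if b ∧ incident G e v then cap G e else 0ℚ) (F≗F′ e))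

deg-nonNeg : ∀ {n} (G : Graph n) F v → 0ℚ ≤ deg G F v
deg-nonNeg G F v = sumF-nonNeg (λ e → if-nonNeg (F e ∧ incident G e v) (<⇒≤ (capPos G e)))

deg-∪ : ∀ {n} (G : Graph n) (F F′ : EdgeSet G) v →
  deg G (_∪_ {G = G} F F′) v ≤ deg G F v + deg G F′ v
deg-∪ G F F′ v = subst (deg G (_∪_ {G = G} F F′) v ≤_) (sumF-distrib-+ (term F) (term F′))
  (sumF-mono-≤ (λ e → if-∨-≤ (F e) (F′ e) (incident G e v) (<⇒≤ (capPos G e))))
  where
  term : EdgeSet G → Fin (m G) → ℚ
  term H e = if H e ∧ incident G e v then cap G e else 0ℚ
  if-∨-≤ : ∀ a b c {x} → 0ℚ ≤ x →
    (if (a ∨ b) ∧ c then x else 0ℚ) ≤ (if a ∧ c then x else 0ℚ) + (if b ∧ c then x else 0ℚ)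
  if-∨-≤ true  b c {x} 0≤x = subst (_≤ (if c then x else 0ℚ) + (if b ∧ c then x else 0ℚ))
    (+-identityʳ (if c then x else 0ℚ)) (+-monoʳ-≤ (if c then x else 0ℚ) (if-nonNeg (b ∧ c) 0≤x))
  if-∨-≤ false b c 0≤x = ≤-reflexive (sym (+-identityˡ _))

range-last : ∀ L → range L L ≡ L ∷ []
range-last L rewrite ℕₚ.n∸n≡0 L = cong (_∷ []) (ℕₚ.+-identityʳ L)

range-step : ∀ {i L} → i ℕ.< L → range i L ≡ i ∷ range (suc i) L
range-step {i} {suc L} (s≤s i≤L) rewrite ℕₚ.+-∸-assoc 1 i≤L =
  cong₂ _∷_ (ℕₚ.+-identityʳ i) (shift-upTo (suc (L ∸ i)))
  where
  open ≡-Reasoning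
  shift-upTo : ∀ k → map (i ℕ.+_) (applyUpTo suc k) ≡ map (suc i ℕ.+_) (upTo k)
  shift-upTo k = begin
    map (i ℕ.+_) (applyUpTo suc k)      ≡⟨ Listₚ.map-applyUpTo suc (i ℕ.+_) k ⟩
    applyUpTo (λ x → i ℕ.+ suc x) k     ≡⟨ sym (Listₚ.map-upTo (λ x → i ℕ.+ suc x) k) ⟩
    map (λ x → i ℕ.+ suc x) (upTo k)    ≡⟨ Listₚ.map-cong (ℕₚ.+-suc i) (upTo k) ⟩
    map (suc i ℕ.+_) (upTo k)           ∎

not-∧ : ∀ a b → not (a ∧ b) ≡ not a ∨ not b
not-∧ true  b = refl
not-∧ false b = refl

module _ {n} (G : Graph n) (P : ℕ → Partition n) (L : ℕ) where

  private
    agree : Fin (m G) → ℕ → Bool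
    agree e j = P j (src G e) == P j (tgt G e)

  ∂R≥-last : ∀ e → ∂R≥ G P L L e ≡ ∂P G (P L) e
  ∂R≥-last e = trans (cong (not ∘ allL (agree e)) (range-last L))
                     (cong not (Boolₚ.∧-identityʳ (agree e L)))

  ∂R≥-step : ∀ {i} → i ℕ.< L →
    ∀ e → ∂R≥ G P L i e ≡ (_∪_ {G = G} (∂P G (P i)) (∂R≥ G P L (suc i))) e
  ∂R≥-step {i} i<L e = trans (cong (not ∘ allL (agree e)) (range-step i<L)) (not-∧ (agree e i) _)

-- Routing back level by level

two : ℚ
two = ι (ℤ.+ 2)

module Levels {n} (G : Graph n) (β : ℚ) (L : ℕ) (P : ℕ → Partition n)
  (return-flow : ∀ i → 1 ℕ.≤ i → i ℕ.≤ L ∸ 1 → Σ (Flow G) λ f → Σ (Fin n → ℚ) λ s →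
     (∀ v → 0ℚ ≤ s v) × (∀ v → s v ≤ ½ * deg G (∂P G (P i)) v) ×
     Routes G f (λ v → s v - deg G (∂P G (P (suc i))) v) ×
     CongestionAtMost G f β) where

  D : ℕ → Fin n → ℚ
  D i = deg G (∂P G (P i))

  ReturnsTo : ℕ → (Fin n → ℚ) → ℚ → Set
  ReturnsTo i x c = Σ (Fin n → ℚ) λ y →
    (∀ v → 0ℚ ≤ y v) × (∀ v → y v ≤ D i v) × Routable G (λ v → x v - y v) c

  return-level : ∀ i → 1 ℕ.≤ i → i ℕ.≤ L ∸ 1 → ∀ k → 0ℚ ≤ k → k * ½ ≤ 1ℚ →
    ∀ z → (∀ v → 0ℚ ≤ z v) → (∀ v → z v ≤ k * D (suc i) v) → ReturnsTo i z (k * β)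
  return-level i 1≤i i≤L-1 k 0≤k k½≤1 z z≥0 z≤kD with return-flow i 1≤i i≤L-1
  ... | f , s , s≥0 , s≤½D , f-routes , f-cong =
    received , received≥0 , received≤D , (λ e → - 1ℚ * flow e) , reverse-routes , reverse-cong
    where
    kf-routes : Routes G (λ e → k * f e) (λ v → k * s v - k * D (suc i) v)
    kf-routes v = trans (netIn-* G k f v)
      (trans (cong (k *_) (f-routes v)) (sym (*-distribˡ-minus k (s v) (D (suc i) v))))
    open SubFlow (subflow G (λ e → k * f e) (λ v → k * s v) (λ v → k * D (suc i) v) z
                    (λ v → 0≤p*q 0≤k (s≥0 v)) kf-routes z≥0 z≤kD)
    received≤D : ∀ v → received v ≤ D i v
    received≤D v = begin
      received v           ≤⟨ received≤s v ⟩
      k * s v              ≤⟨ *-monoˡ-≤-nonNeg k {{nonNegative 0≤k}} (s≤½D v) ⟩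
      k * (½ * D i v)      ≡⟨ sym (*-assoc k ½ (D i v)) ⟩
      k * ½ * D i v        ≤⟨ *-monoʳ-≤-nonNeg (D i v) {{nonNegative (deg-nonNeg G _ v)}} k½≤1 ⟩
      1ℚ * D i v           ≡⟨ *-identityˡ (D i v) ⟩
      D i v                ∎
      where open ≤-Reasoning
    reverse-routes : Routes G (λ e → - 1ℚ * flow e) (λ v → z v - received v)
    reverse-routes v = trans (netIn-* G (- 1ℚ) flow v) (trans (cong (- 1ℚ *_) (routes v))
      (solve 2 (λ y z → (:- con 1ℚ) :* (y :- z) := z :- y) refl (received v) (z v)))
    reverse-cong : CongestionAtMost G (λ e → - 1ℚ * flow e) (k * β)
    reverse-cong e = begin
      ∣ - 1ℚ * flow e ∣    ≡⟨ trans (∣p*q∣≡∣p∣*∣q∣ (- 1ℚ) (flow e)) (*-identityˡ ∣ flow e ∣) ⟩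
      ∣ flow e ∣           ≤⟨ dominated e ⟩
      ∣ k * f e ∣          ≡⟨ trans (∣p*q∣≡∣p∣*∣q∣ k (f e)) (cong (_* ∣ f e ∣) (0≤p⇒∣p∣≡p 0≤k)) ⟩
      k * ∣ f e ∣          ≤⟨ *-monoˡ-≤-nonNeg k {{nonNegative 0≤k}} (f-cong e) ⟩
      k * (β * cap G e)    ≡⟨ sym (*-assoc k β (cap G e)) ⟩
      k * β * cap G e      ∎
      where open ≤-Reasoning

  ∂R≥-top : ∀ j → j ≡ L → ∀ e → ∂R≥ G P L j e ≡ ∂P G (P j) e
  ∂R≥-top j refl = ∂R≥-last G P L

  return-level-step : ∀ i → 1 ℕ.≤ i → i ℕ.≤ L ∸ 1 → ∀ x c → (∀ v → 0ℚ ≤ x v) →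
    ReturnsTo (suc i) (λ v → x v - x v ⊓ D (suc i) v) c → ReturnsTo i x (c + two * β)
  return-level-step i 1≤i i≤L-1 x c x≥0 (y′ , y′≥0 , y′≤D , high-routable) =
    combine (return-level i 1≤i i≤L-1 two (<⇒≤ (0<ι[1+n] 1)) (≤-reflexive two*½≡1) z z≥0 z≤2D)
    where
    two*½≡1 : two * ½ ≡ 1ℚ
    two*½≡1 = refl
    z : Fin n → ℚ
    z v = x v ⊓ D (suc i) v + y′ v
    z≥0 : ∀ v → 0ℚ ≤ z v
    z≥0 v = +-mono-≤ (⊓-glb (x≥0 v) (deg-nonNeg G _ v)) (y′≥0 v)
    z≤2D : ∀ v → z v ≤ two * D (suc i) v
    z≤2D v = subst (z v ≤_) (solve 1 (λ d → d :+ d := con two :* d) refl (D (suc i) v))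
               (+-mono-≤ (p⊓q≤q (x v) (D (suc i) v)) (y′≤D v))
    combine : ReturnsTo i z (two * β) → ReturnsTo i x (c + two * β)
    combine (y , y≥0 , y≤D , low-routable) =
      y , y≥0 , y≤D ,
      Routable-cong G {c = c + two * β} telescope refl
        (Routable-+ G {c = c} {two * β} high-routable low-routable)
      where
      telescope : ∀ v → (x v - x v ⊓ D (suc i) v - y′ v) + (z v - y v) ≡ x v - y v
      telescope v = solve 4 (λ x a b y → (x :- a :- b) :+ (a :+ b :- y) := x :- y) refl
                      (x v) (x v ⊓ D (suc i) v) (y′ v) (y v)

  suc[i+d]≡L⇒i≤L∸1 : ∀ {i d} → suc (i ℕ.+ d) ≡ L → i ℕ.≤ L ∸ 1
  suc[i+d]≡L⇒i≤L∸1 {i} {d} eq = subst (i ℕ.≤_) (cong ℕ.pred eq) (ℕₚ.m≤m+n i d)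

  return-ℛ≥ : ∀ d i → 1 ℕ.≤ i → suc (i ℕ.+ d) ≡ L →
    ∀ x → (∀ v → 0ℚ ≤ x v) → (∀ v → x v ≤ deg G (∂R≥ G P L (suc i)) v) →
    ReturnsTo i x (ι (ℤ.+ suc (2 ℕ.* d)) * β)
  return-ℛ≥ zero i 1≤i i+1≡L x x≥0 x≤R =
    subst (ReturnsTo i x) (cong (_* β) ι[1]≡1)
      (return-level i 1≤i (suc[i+d]≡L⇒i≤L∸1 i+1≡L) 1ℚ (<⇒≤ (positive⁻¹ 1ℚ)) (*≤* (ℤ.+≤+ (s≤s z≤n)))
         x x≥0 x≤D)
    where
    ι[1]≡1 : 1ℚ ≡ ι (ℤ.+ 1)
    ι[1]≡1 = refl
    x≤D : ∀ v → x v ≤ 1ℚ * D (suc i) v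
    x≤D v = subst (x v ≤_) (trans (deg-cong G (∂R≥-top (suc i) 1+i≡L) v) (sym (*-identityˡ (D (suc i) v))))
              (x≤R v)
      where 1+i≡L = trans (cong suc (sym (ℕₚ.+-identityʳ i))) i+1≡L
  return-ℛ≥ (suc d) i 1≤i i+d+2≡L x x≥0 x≤R =
    subst (ReturnsTo i x) constant-step
      (return-level-step i 1≤i (suc[i+d]≡L⇒i≤L∸1 i+d+2≡L) x (ι (ℤ.+ suc (2 ℕ.* d)) * β) x≥0
        (return-ℛ≥ d (suc i) (s≤s z≤n) i′+d+1≡L (λ v → x v - x v ⊓ D (suc i) v) high≥0 high≤R))
    where
    i′+d+1≡L : suc (suc i ℕ.+ d) ≡ L
    i′+d+1≡L = trans (cong suc (sym (ℕₚ.+-suc i d))) i+d+2≡L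
    1+i<L : suc i ℕ.< L
    1+i<L = subst (suc (suc i) ℕ.≤_) i′+d+1≡L (s≤s (s≤s (ℕₚ.m≤m+n i d)))
    high≥0 : ∀ v → 0ℚ ≤ x v - x v ⊓ D (suc i) v
    high≥0 v = p≤q⇒0≤q-p (p⊓q≤p (x v) (D (suc i) v))
    high≤R : ∀ v → x v - x v ⊓ D (suc i) v ≤ deg G (∂R≥ G P L (suc (suc i))) v
    high≤R v = p-[p⊓q]≤r (≤-trans (x≤R v) R≤D+R′) (deg-nonNeg G (∂R≥ G P L (suc (suc i))) v)
      where
      R≤D+R′ : deg G (∂R≥ G P L (suc i)) v ≤ D (suc i) v + deg G (∂R≥ G P L (suc (suc i))) v
      R≤D+R′ = subst (_≤ D (suc i) v + deg G (∂R≥ G P L (suc (suc i))) v)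
                 (sym (deg-cong G (∂R≥-step G P L 1+i<L) v)) (deg-∪ G (∂P G (P (suc i))) (∂R≥ G P L (suc (suc i))) v)
    constant-step : ι (ℤ.+ suc (2 ℕ.* d)) * β + two * β ≡ ι (ℤ.+ suc (2 ℕ.* suc d)) * β
    constant-step = trans (sym (*-distribʳ-+ β (ι (ℤ.+ suc (2 ℕ.* d))) two))
      (cong (_* β) (trans (sym (ι-homo-+ (ℤ.+ suc (2 ℕ.* d)) (ℤ.+ 2))) (cong (ι ∘ ℤ.+_) (1+2d+2≡1+2[1+d] d))))
      where
      1+2d+2≡1+2[1+d] : ∀ d → suc (2 ℕ.* d) ℕ.+ 2 ≡ suc (2 ℕ.* suc d)
      1+2d+2≡1+2[1+d] = solve-∀

suc[L∸1]≡L : ∀ {i L} → 1 ℕ.≤ i → i ℕ.≤ L ∸ 1 → suc (L ∸ 1) ≡ L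
suc[L∸1]≡L {L = suc L} _       _  = refl
suc[L∸1]≡L {L = zero}  (s≤s _) ()

2[1+i+d]∸1∸2i≡1+2d : ∀ i d → 2 ℕ.* suc (i ℕ.+ d) ∸ 1 ∸ 2 ℕ.* i ≡ suc (2 ℕ.* d)
2[1+i+d]∸1∸2i≡1+2d i d =
  trans (cong (λ k → k ∸ 1 ∸ 2 ℕ.* i) (expand i d)) (ℕₚ.m+n∸m≡n (2 ℕ.* i) (suc (2 ℕ.* d)))
  where
  expand : ∀ i d → 2 ℕ.* suc (i ℕ.+ d) ≡ suc (2 ℕ.* i ℕ.+ suc (2 ℕ.* d))
  expand = solve-∀

claim4p9 : ∀ {n} (G : Graph n) (α β : ℚ) → 1ℚ ≤ α → 1ℚ ≤ β →
    (L : ℕ) (P : ℕ → Partition n) →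
    (∀ u v → P 1 u ≡ P 1 v → u ≡ v) →
    (∀ i → 1 Data.Nat.≤ i → i Data.Nat.≤ L ∸ 1 →
      MixesSimultaneously G (mixVec G (P i) (P (suc i))) α) →
    (∀ i → 1 Data.Nat.≤ i → i Data.Nat.≤ L ∸ 1 →
      Σ (Flow G) λ f → Σ (Fin n → ℚ) λ s →
        (∀ v → 0ℚ ≤ s v) × (∀ v → s v ≤ ½ * deg G (∂P G (P i)) v) ×
        Routes G f (λ v → s v - deg G (∂P G (P (suc i))) v) ×
        CongestionAtMost G f β) →
    ∀ i → 1 Data.Nat.≤ i → i Data.Nat.≤ L ∸ 1 →
    (x : Fin n → ℚ) → (∀ v → 0ℚ ≤ x v) →
    (∀ v → x v ≤ deg G (∂R≥ G P L (suc i)) v) →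
    Σ (Fin n → ℚ) λ y → (∀ v → 0ℚ ≤ y v) × (∀ v → y v ≤ deg G (∂P G (P i)) v) ×
      Routable G (λ v → x v - y v) ((+ (2 Data.Nat.* L ∸ 1 ∸ 2 Data.Nat.* i) / 1) * β)
claim4p9 G α β _ _ L P _ _ return-flow i 1≤i i≤L∸1 x x≥0 x≤R =
  subst (ReturnsTo i x) (cong (λ k → ι (ℤ.+ k) * β) (sym constant))
    (return-ℛ≥ d i 1≤i i+d+1≡L x x≥0 x≤R)
  where
  open Levels G β L P return-flow
  d = L ∸ 1 ∸ i
  i+d+1≡L : suc (i ℕ.+ d) ≡ L
  i+d+1≡L = trans (cong suc (ℕₚ.m+[n∸m]≡n i≤L∸1)) (suc[L∸1]≡L 1≤i i≤L∸1)
  constant : 2 ℕ.* L ∸ 1 ∸ 2 ℕ.* i ≡ suc (2 ℕ.* d)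
  constant = trans (cong (λ l → 2 ℕ.* l ∸ 1 ∸ 2 ℕ.* i) (sym i+d+1≡L)) (2[1+i+d]∸1∸2i≡1+2d i d)
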